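{- Let $\mathbb K$ be a field of characteristic zero, $\mathfrak d$ a delta operator on $\mathbb K[x]$ with basic sequence $(p_n(x))_{n\ge0}$, $\mathcal Z=(z_i)_{i\ge0}$ a sequence in $\mathbb K$, and $(t_n(x))_{n\ge0}$ the generalized Gončarov basis associated with $(\mathfrak d,\mathcal Z)$. Then for all $n\in\mathbb N$, $$p_n(x)=\sum_{i=0}^n\binom ni p_{n-i}(z_i)\,t_i(x),$$ and hence $t_n(x)=p_n(x)-\sum_{i=0}^{n-1}\binom ni p_{n-i}(z_i)\,t_i(x)$.
   Context: A shift-invariant operator on $\mathbb K[x]$ is a linear operator commuting with all shifts $f(x)\mapsto f(x+a)$; a delta operator is a shift-invariant operator $\mathfrak d$ with $\mathfrak d(x)$ a nonzero constant. The basic sequence of $\mathfrak d$ is the unique polynomial sequence $(p_n)_{n\ge0}$ with $p_0=1$, $p_n(0)=0$ for $n\ge1$, and $\mathfrak d(p_n)=np_{n-1}$. The generalized Gončarov basis associated with $(\mathfrak d,\mathcal Z)$ is the unique sequence of polynomials $(t_n)_{n\ge0}$ with $\deg t_n=n$ and $\varepsilon_{z_i}(\mathfrak d^i t_n)=n!\,\delta_{i,n}$ for all $i,n$ ($\varepsilon_z$ evaluation at $z$, $\mathfrak d^i$ the $i$-th iterate). -}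

module Defs where

open import Level using (Level; _⊔_)
open import Algebra.Bundles using (CommutativeRing)
open import Data.Nat using (ℕ; zero; suc; _<_; _∸_; _!)
open import Data.Nat.Combinatorics using (_C_)
open import Data.List using (List; []; _∷_; map)
open import Data.Product using (Σ; _×_)
open import Relation.Nullary using (¬_)
open import Relation.Binary.PropositionalEquality using (_≡_; _≢_)

record IsField {c ℓ : Level} (K : CommutativeRing c ℓ) : Set (c ⊔ ℓ) where
  open CommutativeRing K
  field
    nontrivial : ¬ (1# ≈ 0#)
    inverse    : ∀ x → ¬ (x ≈ 0#) → Σ Carrier (λ y → x * y ≈ 1#)

module Poly {c ℓ : Level} (K : CommutativeRing c ℓ) where
  open CommutativeRing K public

  ι : ℕ → Carrier
  ι zero    = 0#
  ι (suc n) = 1# + ι n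

  CharZero : Set ℓ
  CharZero = ∀ n → ¬ (ι (suc n) ≈ 0#)

  -- polynomials in K[x] as coefficient lists (constant term first)
  Poly : Set c
  Poly = List Carrier

  coeff : Poly → ℕ → Carrier
  coeff []       _       = 0#
  coeff (a ∷ _)  zero    = a
  coeff (_ ∷ as) (suc n) = coeff as n

  -- equality of polynomials: equal coefficients (trailing zeros irrelevant)
  infix 4 _≈ₚ_
  _≈ₚ_ : Poly → Poly → Set ℓ
  f ≈ₚ g = ∀ n → coeff f n ≈ coeff g n

  infixl 6 _+ₚ_
  _+ₚ_ : Poly → Poly → Poly
  []       +ₚ g        = g
  (a ∷ as) +ₚ []       = a ∷ as
  (a ∷ as) +ₚ (b ∷ bs) = (a + b) ∷ (as +ₚ bs)

  infixr 7 _·ₚ_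
  _·ₚ_ : Carrier → Poly → Poly
  a ·ₚ f = map (a *_) f

  const : Carrier → Poly
  const a = a ∷ []

  X : Poly
  X = 0# ∷ 1# ∷ []

  eval : Carrier → Poly → Carrier
  eval z []       = 0#
  eval z (a ∷ as) = a + z * eval z as

  -- the shift f(x) ↦ f(x + a)
  shift : Carrier → Poly → Poly
  shift a []       = []
  shift a (b ∷ bs) = const b +ₚ ((0# ∷ s) +ₚ (a ·ₚ s))
    where s = shift a bs

  HasDegree : Poly → ℕ → Set ℓ
  HasDegree f n = ¬ (coeff f n ≈ 0#) × (∀ m → n < m → coeff f m ≈ 0#)

  sumₚ : ℕ → (ℕ → Poly) → Poly
  sumₚ zero    f = []
  sumₚ (suc n) f = sumₚ n f +ₚ f n

  iter : (Poly → Poly) → ℕ → Poly → Poly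
  iter L zero    f = f
  iter L (suc i) f = L (iter L i f)

  record IsLinear (L : Poly → Poly) : Set (c ⊔ ℓ) where
    field
      cong-≈ : ∀ f g → f ≈ₚ g → L f ≈ₚ L g
      additive : ∀ f g → L (f +ₚ g) ≈ₚ L f +ₚ L g
      homogeneous : ∀ a f → L (a ·ₚ f) ≈ₚ a ·ₚ L f

  ShiftInvariant : (Poly → Poly) → Set (c ⊔ ℓ)
  ShiftInvariant L = ∀ a f → L (shift a f) ≈ₚ shift a (L f)

  record IsDeltaOperator (L : Poly → Poly) : Set (c ⊔ ℓ) where
    field
      linear : IsLinear L
      shiftInvariant : ShiftInvariant L
      dx : Σ Carrier (λ k → ¬ (k ≈ 0#) × (L X ≈ₚ const k))

  record IsBasicSequence (d : Poly → Poly) (p : ℕ → Poly) : Set (c ⊔ ℓ) where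
    field
      degree : ∀ n → HasDegree (p n) n
      p₀ : p 0 ≈ₚ const 1#
      vanish : ∀ n → eval 0# (p (suc n)) ≈ 0#
      d-p₀ : d (p 0) ≈ₚ []
      d-pₙ : ∀ n → d (p (suc n)) ≈ₚ ι (suc n) ·ₚ p n

  record IsGoncarovBasis (d : Poly → Poly) (z : ℕ → Carrier) (t : ℕ → Poly) : Set (c ⊔ ℓ) where
    field
      degree : ∀ n → HasDegree (t n) n
      diag : ∀ n → eval (z n) (iter d n (t n)) ≈ ι (n !)
      offdiag : ∀ i n → i ≢ n → eval (z i) (iter d i (t n)) ≈ 0#

-- The basis (tₙ) is triangular (deg tᵢ = i), so over a field pₙ = Σ_{i≤n} aᵢ tᵢ for some
-- scalars aᵢ. The functionals φₖ = ε_{z_k} ∘ 𝔡ᵏ are biorthogonal to (tᵢ): φₖ(tᵢ) = k! δᵢₖ.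
-- Applying φₖ gives aₖ k! = φₖ(pₙ) = n(n-1)⋯(n-k+1) p_{n-k}(z_k) = C(n,k) k! p_{n-k}(z_k),
-- and k! is invertible in characteristic zero. The recursion for tₙ is the case i = n
-- moved to the other side, since C(n,n) p₀(z_n) = 1.
module Submission where

open import Defs
open import Level using (Level; _⊔_)
open import Algebra.Bundles using (CommutativeRing)
open import Data.Nat as ℕ using (ℕ; zero; suc; _∸_; _≤_; _<_; z≤n; s≤s; _!)
open import Data.Nat.Properties as ℕₚ using (_≟_)
open import Data.Nat.Combinatorics using (_C_; nCk≡nPk/k!; nCn≡1)
open import Data.Nat.Combinatorics.Base using (_P′_; _P_)
open import Data.Nat.Combinatorics.Specification using (k!∣nP′k; nPk≡n!/[n∸k]!; nP′k≡n!/[n∸k]!)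
open import Data.Nat.DivMod using (_/_; m/n*n≡m)
open import Data.List using ([]; _∷_)
open import Data.Product using (Σ; _×_; _,_; proj₁; proj₂)
open import Relation.Nullary using (¬_; yes; no; contradiction)
open import Relation.Binary.PropositionalEquality as ≡ using (_≡_; _≢_)

nP′k≡nCk*k! : ∀ {n k} → k ≤ n → n P′ k ≡ (n C k) ℕ.* k !
nP′k≡nCk*k! {n} {k} k≤n = begin
  n P′ k                       ≡⟨ m/n*n≡m (k!∣nP′k k≤n) ⟨
  (n P′ k) / k ! ℕ.* k !       ≡⟨ ≡.cong (λ m → m / k ! ℕ.* k !)
                                    (≡.trans (nP′k≡n!/[n∸k]! k≤n) (≡.sym (nPk≡n!/[n∸k]! k≤n))) ⟩
  (n P k) / k ! ℕ.* k !        ≡⟨ ≡.cong (ℕ._* k !) (nCk≡nPk/k! k≤n) ⟨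
  (n C k) ℕ.* k !              ∎
  where
  open ≡.≡-Reasoning
  instance _ = k ℕₚ.!≢0

update : ∀ {a} {A : Set a} → (ℕ → A) → ℕ → A → ℕ → A
update f n v i with i ≟ n
... | yes _ = v
... | no  _ = f i

update-≡ : ∀ {a} {A : Set a} (f : ℕ → A) n v → update f n v n ≡ v
update-≡ f n v with n ≟ n
... | yes _   = ≡.refl
... | no  n≢n = contradiction ≡.refl n≢n

update-≢ : ∀ {a} {A : Set a} (f : ℕ → A) {n} v {i} → i ≢ n → update f n v i ≡ f i
update-≢ f {n} v {i} i≢n with i ≟ n
... | yes i≡n = contradiction i≡n i≢n
... | no  _   = ≡.refl

module PolynomialAlgebra {c ℓ : Level} (K : CommutativeRing c ℓ) where
  open Poly K
  open import Relation.Binary.Reasoning.Setoid setoid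
  open import Algebra.Properties.Ring ring using (-‿distribˡ-*; -1*x≈-x)
  open import Algebra.Properties.CommutativeSemigroup *-commutativeSemigroup using (x∙yz≈y∙xz)
  open import Algebra.Properties.CommutativeSemigroup +-commutativeSemigroup using (interchange)

  ≡⇒≈ : ∀ {x y} → x ≡ y → x ≈ y
  ≡⇒≈ ≡.refl = refl

  ≈ₚ-refl : ∀ f → f ≈ₚ f
  ≈ₚ-refl f n = refl

  ≈ₚ-trans : ∀ f g h → f ≈ₚ g → g ≈ₚ h → f ≈ₚ h
  ≈ₚ-trans f g h f≈g g≈h n = trans (f≈g n) (g≈h n)

  coeff-+ₚ : ∀ f g n → coeff (f +ₚ g) n ≈ coeff f n + coeff g n
  coeff-+ₚ []       g        n       = sym (+-identityˡ _)
  coeff-+ₚ (a ∷ as) []       n       = sym (+-identityʳ _)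
  coeff-+ₚ (a ∷ as) (b ∷ bs) zero    = refl
  coeff-+ₚ (a ∷ as) (b ∷ bs) (suc n) = coeff-+ₚ as bs n

  coeff-·ₚ : ∀ a f n → coeff (a ·ₚ f) n ≈ a * coeff f n
  coeff-·ₚ a []      n       = sym (zeroʳ a)
  coeff-·ₚ a (b ∷ f) zero    = refl
  coeff-·ₚ a (b ∷ f) (suc n) = coeff-·ₚ a f n

  coeff-+ₚ-·ₚ : ∀ f a g n → coeff (f +ₚ a ·ₚ g) n ≈ coeff f n + a * coeff g n
  coeff-+ₚ-·ₚ f a g n = trans (coeff-+ₚ f (a ·ₚ g) n) (+-congˡ (coeff-·ₚ a g n))

  +ₚ-cong : ∀ f f′ g g′ → f ≈ₚ f′ → g ≈ₚ g′ → f +ₚ g ≈ₚ f′ +ₚ g′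
  +ₚ-cong f f′ g g′ f≈f′ g≈g′ n =
    trans (coeff-+ₚ f g n) (trans (+-cong (f≈f′ n) (g≈g′ n)) (sym (coeff-+ₚ f′ g′ n)))

  ·ₚ-cong : ∀ {a b} f g → a ≈ b → f ≈ₚ g → a ·ₚ f ≈ₚ b ·ₚ g
  ·ₚ-cong {a} {b} f g a≈b f≈g n =
    trans (coeff-·ₚ a f n) (trans (*-cong a≈b (f≈g n)) (sym (coeff-·ₚ b g n)))

  sumₚ-cong : ∀ n F G → (∀ i → i < n → F i ≈ₚ G i) → sumₚ n F ≈ₚ sumₚ n G
  sumₚ-cong zero    F G F≈G = ≈ₚ-refl []
  sumₚ-cong (suc n) F G F≈G = +ₚ-cong (sumₚ n F) (sumₚ n G) (F n) (G n)
    (sumₚ-cong n F G (λ i i<n → F≈G i (ℕₚ.m<n⇒m<1+n i<n))) (F≈G n ℕₚ.≤-refl)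

  +ₚ-·ₚ-cancel : ∀ f a h → f ≈ₚ (f +ₚ (- a) ·ₚ h) +ₚ a ·ₚ h
  +ₚ-·ₚ-cancel f a h n = begin
    coeff f n                                           ≈⟨ +-identityʳ _ ⟨
    coeff f n + 0#                                      ≈⟨ +-congˡ (-‿inverseˡ (a * coeff h n)) ⟨
    coeff f n + (- (a * coeff h n) + a * coeff h n)     ≈⟨ +-assoc _ _ _ ⟨
    (coeff f n + - (a * coeff h n)) + a * coeff h n     ≈⟨ +-cong (+-congˡ (sym (-‿distribˡ-* a _)))
                                                                  (coeff-·ₚ a h n) ⟨
    (coeff f n + (- a) * coeff h n) + coeff (a ·ₚ h) n  ≈⟨ +-congʳ (coeff-+ₚ-·ₚ f (- a) h n) ⟨
    coeff (f +ₚ (- a) ·ₚ h) n + coeff (a ·ₚ h) n        ≈⟨ coeff-+ₚ (f +ₚ (- a) ·ₚ h) (a ·ₚ h) n ⟨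
    coeff ((f +ₚ (- a) ·ₚ h) +ₚ a ·ₚ h) n               ∎

  ≈ₚ-+ₚ-solveʳ : ∀ f g h {a} → a ≈ 1# → f ≈ₚ g +ₚ a ·ₚ h → h ≈ₚ f +ₚ (- 1#) ·ₚ g
  ≈ₚ-+ₚ-solveʳ f g h {a} a≈1 f≈g+ah n = sym (begin
    coeff (f +ₚ (- 1#) ·ₚ g) n                    ≈⟨ coeff-+ₚ-·ₚ f (- 1#) g n ⟩
    coeff f n + (- 1#) * coeff g n                ≈⟨ +-cong (f≈g+ah n) (-1*x≈-x _) ⟩
    coeff (g +ₚ a ·ₚ h) n - coeff g n             ≈⟨ +-congʳ (coeff-+ₚ-·ₚ g a h n) ⟩
    (coeff g n + a * coeff h n) - coeff g n       ≈⟨ +-congʳ (+-cong refl (trans (*-congʳ a≈1) (*-identityˡ _))) ⟩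
    (coeff g n + coeff h n) - coeff g n           ≈⟨ +-congʳ (+-comm _ _) ⟩
    (coeff h n + coeff g n) - coeff g n           ≈⟨ +-assoc _ _ _ ⟩
    coeff h n + (coeff g n - coeff g n)           ≈⟨ +-congˡ (-‿inverseʳ _) ⟩
    coeff h n + 0#                                ≈⟨ +-identityʳ _ ⟩
    coeff h n                                     ∎)

  eval-≈[] : ∀ z f → f ≈ₚ [] → eval z f ≈ 0#
  eval-≈[] z []       f≈0 = refl
  eval-≈[] z (a ∷ as) f≈0 = begin
    a + z * eval z as  ≈⟨ +-cong (f≈0 0) (*-congˡ (eval-≈[] z as (λ n → f≈0 (suc n)))) ⟩
    0# + z * 0#        ≈⟨ +-identityˡ _ ⟩
    z * 0#             ≈⟨ zeroʳ z ⟩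
    0#                 ∎

  eval-cong : ∀ z f g → f ≈ₚ g → eval z f ≈ eval z g
  eval-cong z []       g        f≈g = sym (eval-≈[] z g (λ n → sym (f≈g n)))
  eval-cong z (a ∷ as) []       f≈g = eval-≈[] z (a ∷ as) f≈g
  eval-cong z (a ∷ as) (b ∷ bs) f≈g =
    +-cong (f≈g 0) (*-congˡ (eval-cong z as bs (λ n → f≈g (suc n))))

  eval-+ₚ : ∀ z f g → eval z (f +ₚ g) ≈ eval z f + eval z g
  eval-+ₚ z []       g        = sym (+-identityˡ _)
  eval-+ₚ z (a ∷ as) []       = sym (+-identityʳ _)
  eval-+ₚ z (a ∷ as) (b ∷ bs) = begin
    (a + b) + z * eval z (as +ₚ bs)            ≈⟨ +-congˡ (*-congˡ (eval-+ₚ z as bs)) ⟩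
    (a + b) + z * (eval z as + eval z bs)      ≈⟨ +-congˡ (distribˡ z _ _) ⟩
    (a + b) + (z * eval z as + z * eval z bs)  ≈⟨ interchange a b _ _ ⟩
    (a + z * eval z as) + (b + z * eval z bs)  ∎

  eval-·ₚ : ∀ z a f → eval z (a ·ₚ f) ≈ a * eval z f
  eval-·ₚ z a []       = sym (zeroʳ a)
  eval-·ₚ z a (b ∷ bs) = begin
    a * b + z * eval z (a ·ₚ bs)  ≈⟨ +-congˡ (*-congˡ (eval-·ₚ z a bs)) ⟩
    a * b + z * (a * eval z bs)   ≈⟨ +-congˡ (x∙yz≈y∙xz z a _) ⟩
    a * b + a * (z * eval z bs)   ≈⟨ distribˡ a _ _ ⟨
    a * (b + z * eval z bs)       ∎

  ι-+ : ∀ m n → ι (m ℕ.+ n) ≈ ι m + ι n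
  ι-+ zero    n = sym (+-identityˡ _)
  ι-+ (suc m) n = trans (+-congˡ (ι-+ m n)) (sym (+-assoc _ _ _))

  ι-* : ∀ m n → ι (m ℕ.* n) ≈ ι m * ι n
  ι-* zero    n = sym (zeroˡ _)
  ι-* (suc m) n = begin
    ι (n ℕ.+ m ℕ.* n)      ≈⟨ ι-+ n (m ℕ.* n) ⟩
    ι n + ι (m ℕ.* n)      ≈⟨ +-cong (sym (*-identityˡ _)) (ι-* m n) ⟩
    1# * ι n + ι m * ι n   ≈⟨ distribʳ _ _ _ ⟨
    (1# + ι m) * ι n       ∎

  ι-!≉0 : CharZero → ∀ k → ¬ ι (k !) ≈ 0#
  ι-!≉0 charZero k with k ! | ℕₚ.1≤n! k
  ... | suc m | _ = charZero m

  linear-[] : ∀ {L} → IsLinear L → L [] ≈ₚ []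
  linear-[] {L} lin n = begin
    coeff (L []) n          ≈⟨ IsLinear.homogeneous lin 0# [] n ⟩
    coeff (0# ·ₚ L []) n    ≈⟨ coeff-·ₚ 0# (L []) n ⟩
    0# * coeff (L []) n     ≈⟨ zeroˡ _ ⟩
    0#                      ∎

  iter-linear : ∀ {L} → IsLinear L → ∀ k → IsLinear (iter L k)
  iter-linear {L} lin zero = record
    { cong-≈      = λ f g f≈g → f≈g
    ; additive    = λ f g → ≈ₚ-refl (f +ₚ g)
    ; homogeneous = λ a f → ≈ₚ-refl (a ·ₚ f)
    }
  iter-linear {L} lin (suc k) = record
    { cong-≈      = λ f g f≈g → cong-≈ (Lᵏ f) (Lᵏ g) (Lᵏ.cong-≈ f g f≈g)
    ; additive    = λ f g → ≈ₚ-trans (L (Lᵏ (f +ₚ g))) (L (Lᵏ f +ₚ Lᵏ g)) (L (Lᵏ f) +ₚ L (Lᵏ g))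
        (cong-≈ (Lᵏ (f +ₚ g)) (Lᵏ f +ₚ Lᵏ g) (Lᵏ.additive f g)) (additive (Lᵏ f) (Lᵏ g))
    ; homogeneous = λ a f → ≈ₚ-trans (L (Lᵏ (a ·ₚ f))) (L (a ·ₚ Lᵏ f)) (a ·ₚ L (Lᵏ f))
        (cong-≈ (Lᵏ (a ·ₚ f)) (a ·ₚ Lᵏ f) (Lᵏ.homogeneous a f)) (homogeneous a (Lᵏ f))
    }
    where
    open IsLinear lin
    Lᵏ = iter L k
    module Lᵏ = IsLinear (iter-linear lin k)

  record IsLinearFunctional (φ : Poly → Carrier) : Set (c ⊔ ℓ) where
    field
      cong-≈      : ∀ f g → f ≈ₚ g → φ f ≈ φ g
      additive    : ∀ f g → φ (f +ₚ g) ≈ φ f + φ g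
      homogeneous : ∀ a f → φ (a ·ₚ f) ≈ a * φ f

  eval∘linear : ∀ {L} → IsLinear L → ∀ w → IsLinearFunctional (λ f → eval w (L f))
  eval∘linear {L} lin w = record
    { cong-≈      = λ f g f≈g → eval-cong w (L f) (L g) (cong-≈ f g f≈g)
    ; additive    = λ f g → trans (eval-cong w (L (f +ₚ g)) (L f +ₚ L g) (additive f g)) (eval-+ₚ w (L f) (L g))
    ; homogeneous = λ a f → trans (eval-cong w (L (a ·ₚ f)) (a ·ₚ L f) (homogeneous a f)) (eval-·ₚ w a (L f))
    }
    where open IsLinear lin

  module _ {φ : Poly → Carrier} (φ-linear : IsLinearFunctional φ)
           (s : ℕ → Poly) (a : ℕ → Carrier) {k : ℕ}
           (φ-sᵢ : ∀ i → i ≢ k → φ (s i) ≈ 0#) where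
    open IsLinearFunctional φ-linear

    private
      φ-term : ∀ i → i ≢ k → φ (a i ·ₚ s i) ≈ 0#
      φ-term i i≢k = trans (homogeneous (a i) (s i)) (trans (*-congˡ (φ-sᵢ i i≢k)) (zeroʳ _))

      φ-[] : φ [] ≈ 0#
      φ-[] = trans (homogeneous 0# []) (zeroˡ _)

    φ-sum-below : ∀ m → m ≤ k → φ (sumₚ m (λ i → a i ·ₚ s i)) ≈ 0#
    φ-sum-below zero    _     = φ-[]
    φ-sum-below (suc m) m<k = begin
      φ (sumₚ m _ +ₚ a m ·ₚ s m)          ≈⟨ additive _ _ ⟩
      φ (sumₚ m _) + φ (a m ·ₚ s m)       ≈⟨ +-cong (φ-sum-below m (ℕₚ.<⇒≤ m<k))
                                                    (φ-term m (ℕₚ.<⇒≢ m<k)) ⟩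
      0# + 0#                             ≈⟨ +-identityˡ _ ⟩
      0#                                  ∎

    φ-sum-select : ∀ m → k < m → φ (sumₚ m (λ i → a i ·ₚ s i)) ≈ a k * φ (s k)
    φ-sum-select (suc m) (s≤s k≤m) with m ≟ k
    ... | yes ≡.refl = begin
      φ (sumₚ k _ +ₚ a k ·ₚ s k)          ≈⟨ additive _ _ ⟩
      φ (sumₚ k _) + φ (a k ·ₚ s k)       ≈⟨ +-cong (φ-sum-below k ℕₚ.≤-refl) (homogeneous (a k) (s k)) ⟩
      0# + a k * φ (s k)                  ≈⟨ +-identityˡ _ ⟩
      a k * φ (s k)                       ∎
    ... | no m≢k = let k<m = ℕₚ.≤∧≢⇒< k≤m (λ k≡m → m≢k (≡.sym k≡m)) in begin
      φ (sumₚ m _ +ₚ a m ·ₚ s m)          ≈⟨ additive _ _ ⟩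
      φ (sumₚ m _) + φ (a m ·ₚ s m)       ≈⟨ +-cong (φ-sum-select m k<m) (φ-term m m≢k) ⟩
      a k * φ (s k) + 0#                  ≈⟨ +-identityʳ _ ⟩
      a k * φ (s k)                       ∎

module FieldAlgebra {c ℓ : Level} (K : CommutativeRing c ℓ) (isField : IsField K) where
  open Poly K
  open PolynomialAlgebra K
  open import Algebra.Properties.Ring ring using (-‿distribˡ-*)

  *-cancelʳ-≉0 : ∀ x w {y} → ¬ y ≈ 0# → x * y ≈ w * y → x ≈ w
  *-cancelʳ-≉0 x w {y} y≉0 xy≈wy with IsField.inverse isField y y≉0
  ... | y⁻¹ , y*y⁻¹≈1 = begin
    x                ≈⟨ *-identityʳ x ⟨
    x * 1#           ≈⟨ *-congˡ y*y⁻¹≈1 ⟨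
    x * (y * y⁻¹)    ≈⟨ *-assoc _ _ _ ⟨
    (x * y) * y⁻¹    ≈⟨ *-congʳ xy≈wy ⟩
    (w * y) * y⁻¹    ≈⟨ *-assoc _ _ _ ⟩
    w * (y * y⁻¹)    ≈⟨ *-congˡ y*y⁻¹≈1 ⟩
    w * 1#           ≈⟨ *-identityʳ w ⟩
    w                ∎
    where open import Relation.Binary.Reasoning.Setoid setoid

  -- Subtract the multiple of s_{n-1} that kills the coefficient of x^{n-1}, and recurse.
  triangular-spans : (s : ℕ → Poly) → (∀ i → HasDegree (s i) i) →
    ∀ n f → (∀ m → n ≤ m → coeff f m ≈ 0#) →
    Σ (ℕ → Carrier) λ a → f ≈ₚ sumₚ n (λ i → a i ·ₚ s i)
  triangular-spans s deg zero    f f≈0 = (λ _ → 0#) , (λ m → f≈0 m z≤n)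
  triangular-spans s deg (suc n) f f≈0 with IsField.inverse isField (coeff (s n) n) (proj₁ (deg n))
  ... | y , lc*y≈1 = a′ , f≈sum
    where
    open import Relation.Binary.Reasoning.Setoid setoid
    λₙ = coeff f n * y
    g = f +ₚ (- λₙ) ·ₚ s n

    g≈0 : ∀ m → n ≤ m → coeff g m ≈ 0#
    g≈0 m n≤m with n ≟ m
    ... | yes ≡.refl = begin
      coeff g n                                   ≈⟨ coeff-+ₚ-·ₚ f (- λₙ) (s n) n ⟩
      coeff f n + (- λₙ) * coeff (s n) n          ≈⟨ +-congˡ (sym (-‿distribˡ-* λₙ _)) ⟩
      coeff f n - coeff f n * y * coeff (s n) n   ≈⟨ +-congˡ (-‿cong (*-assoc _ _ _)) ⟩
      coeff f n - coeff f n * (y * coeff (s n) n) ≈⟨ +-congˡ (-‿cong (*-congˡ (trans (*-comm _ _) lc*y≈1))) ⟩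
      coeff f n - coeff f n * 1#                  ≈⟨ +-congˡ (-‿cong (*-identityʳ _)) ⟩
      coeff f n - coeff f n                       ≈⟨ -‿inverseʳ _ ⟩
      0#                                          ∎
    ... | no n≢m = begin
      coeff g m                                   ≈⟨ coeff-+ₚ-·ₚ f (- λₙ) (s n) m ⟩
      coeff f m + (- λₙ) * coeff (s n) m          ≈⟨ +-cong (f≈0 m n<m) (*-congˡ (proj₂ (deg n) m n<m)) ⟩
      0# + (- λₙ) * 0#                            ≈⟨ +-identityˡ _ ⟩
      (- λₙ) * 0#                                 ≈⟨ zeroʳ _ ⟩
      0#                                          ∎
      where n<m = ℕₚ.≤∧≢⇒< n≤m n≢m

    g-spanned = triangular-spans s deg n g g≈0
    a = proj₁ g-spanned
    a′ = update a n λₙ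
    S = sumₚ n (λ i → a i ·ₚ s i)
    S′ = sumₚ n (λ i → a′ i ·ₚ s i)

    S≈S′ : S ≈ₚ S′
    S≈S′ = sumₚ-cong n (λ i → a i ·ₚ s i) (λ i → a′ i ·ₚ s i) λ i i<n →
      ·ₚ-cong (s i) (s i) (≡⇒≈ (≡.sym (update-≢ a λₙ (ℕₚ.<⇒≢ i<n)))) (≈ₚ-refl (s i))

    f≈sum : f ≈ₚ S′ +ₚ a′ n ·ₚ s n
    f≈sum = ≈ₚ-trans f (g +ₚ λₙ ·ₚ s n) (S′ +ₚ a′ n ·ₚ s n) (+ₚ-·ₚ-cancel f λₙ (s n))
      (+ₚ-cong g S′ (λₙ ·ₚ s n) (a′ n ·ₚ s n) (≈ₚ-trans g S S′ (proj₂ g-spanned) S≈S′)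
        (·ₚ-cong (s n) (s n) (≡⇒≈ (≡.sym (update-≡ a n λₙ))) (≈ₚ-refl (s n))))

module BasicSequenceDerivatives {c ℓ : Level} (K : CommutativeRing c ℓ)
  {d : Poly.Poly K → Poly.Poly K} (d-linear : Poly.IsLinear K d)
  {p : ℕ → Poly.Poly K} (basic : Poly.IsBasicSequence K d p) where
  open Poly K
  open PolynomialAlgebra K
  open IsLinear d-linear
  open import Relation.Binary.Reasoning.Setoid setoid

  d-p : ∀ {j m} → j ≡ suc m → d (p j) ≈ₚ ι j ·ₚ p m
  d-p ≡.refl = IsBasicSequence.d-pₙ basic _

  iter-d-p : ∀ n k → k ≤ n → iter d k (p n) ≈ₚ ι (n P′ k) ·ₚ p (n ∸ k)
  iter-d-p n zero    _   m = sym (trans (coeff-·ₚ _ (p n) m) (trans (*-congʳ (+-identityʳ 1#)) (*-identityˡ _)))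
  iter-d-p n (suc k) k<n m = begin
    coeff (d (iter d k (p n))) m                       ≈⟨ cong-≈ (iter d k (p n)) (ι (n P′ k) ·ₚ p (n ∸ k))
                                                              (iter-d-p n k (ℕₚ.<⇒≤ k<n)) m ⟩
    coeff (d (ι (n P′ k) ·ₚ p (n ∸ k))) m              ≈⟨ homogeneous (ι (n P′ k)) (p (n ∸ k)) m ⟩
    coeff (ι (n P′ k) ·ₚ d (p (n ∸ k))) m              ≈⟨ coeff-·ₚ _ (d (p (n ∸ k))) m ⟩
    ι (n P′ k) * coeff (d (p (n ∸ k))) m               ≈⟨ *-congˡ (d-p (ℕₚ.+-∸-assoc 1 k<n) m) ⟩
    ι (n P′ k) * coeff (ι (n ∸ k) ·ₚ p (n ∸ suc k)) m  ≈⟨ *-congˡ (coeff-·ₚ _ (p (n ∸ suc k)) m) ⟩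
    ι (n P′ k) * (ι (n ∸ k) * coeff (p (n ∸ suc k)) m) ≈⟨ *-assoc _ _ _ ⟨
    ι (n P′ k) * ι (n ∸ k) * coeff (p (n ∸ suc k)) m   ≈⟨ *-congʳ (trans (*-comm _ _)
                                                                         (sym (ι-* (n ∸ k) (n P′ k)))) ⟩
    ι (n P′ suc k) * coeff (p (n ∸ suc k)) m           ≈⟨ coeff-·ₚ _ (p (n ∸ suc k)) m ⟨
    coeff (ι (n P′ suc k) ·ₚ p (n ∸ suc k)) m          ∎

module GoncarovExpansion {c ℓ : Level} (K : CommutativeRing c ℓ) (isField : IsField K)
  (charZero : Poly.CharZero K)
  {d : Poly.Poly K → Poly.Poly K} (delta : Poly.IsDeltaOperator K d)
  {p : ℕ → Poly.Poly K} (basic : Poly.IsBasicSequence K d p)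
  (z : ℕ → Poly.Carrier K) {t : ℕ → Poly.Poly K} (goncarov : Poly.IsGoncarovBasis K d z t) where
  open Poly K
  open PolynomialAlgebra K
  open FieldAlgebra K isField
  open BasicSequenceDerivatives K (IsDeltaOperator.linear delta) basic
  open import Relation.Binary.Reasoning.Setoid setoid
  module basic = IsBasicSequence basic
  module goncarov = IsGoncarovBasis goncarov

  φ : ℕ → Poly → Carrier
  φ k f = eval (z k) (iter d k f)

  φ-linear : ∀ k → IsLinearFunctional (φ k)
  φ-linear k = eval∘linear (iter-linear (IsDeltaOperator.linear delta) k) (z k)

  coefficient : ℕ → ℕ → Carrier
  coefficient n i = ι (n C i) * eval (z i) (p (n ∸ i))

  φ-p : ∀ {n k} → k ≤ n → φ k (p n) ≈ coefficient n k * ι (k !)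
  φ-p {n} {k} k≤n = begin
    φ k (p n)                                    ≈⟨ eval-cong (z k) (iter d k (p n)) (ι (n P′ k) ·ₚ p (n ∸ k))
                                                                (iter-d-p n k k≤n) ⟩
    eval (z k) (ι (n P′ k) ·ₚ p (n ∸ k))         ≈⟨ eval-·ₚ (z k) _ (p (n ∸ k)) ⟩
    ι (n P′ k) * pₙ₋ₖ[zₖ]                        ≈⟨ *-congʳ (≡⇒≈ (≡.cong ι (nP′k≡nCk*k! k≤n))) ⟩
    ι ((n C k) ℕ.* k !) * pₙ₋ₖ[zₖ]               ≈⟨ *-congʳ (ι-* (n C k) (k !)) ⟩
    ι (n C k) * ι (k !) * pₙ₋ₖ[zₖ]               ≈⟨ *-assoc _ _ _ ⟩
    ι (n C k) * (ι (k !) * pₙ₋ₖ[zₖ])             ≈⟨ *-congˡ (*-comm _ _) ⟩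
    ι (n C k) * (pₙ₋ₖ[zₖ] * ι (k !))             ≈⟨ *-assoc _ _ _ ⟨
    coefficient n k * ι (k !)                    ∎
    where pₙ₋ₖ[zₖ] = eval (z k) (p (n ∸ k))

  coefficient-diag : ∀ n → coefficient n n ≈ 1#
  coefficient-diag n = begin
    ι (n C n) * eval (z n) (p (n ∸ n))  ≈⟨ ≡⇒≈ (≡.cong₂ (λ m j → ι m * eval (z n) (p j))
                                                          (nCn≡1 n) (ℕₚ.n∸n≡0 n)) ⟩
    (1# + 0#) * eval (z n) (p 0)        ≈⟨ *-cong (+-identityʳ _) (eval-cong (z n) (p 0) (const 1#) basic.p₀) ⟩
    1# * (1# + z n * 0#)                ≈⟨ *-identityˡ _ ⟩
    1# + z n * 0#                       ≈⟨ +-congˡ (zeroʳ _) ⟩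
    1# + 0#                             ≈⟨ +-identityʳ _ ⟩
    1#                                  ∎

  expansion : ∀ n → p n ≈ₚ sumₚ (suc n) (λ i → coefficient n i ·ₚ t i)
  expansion n = ≈ₚ-trans (p n) (sumₚ (suc n) aₜ) (sumₚ (suc n) cₜ) (proj₂ p-spanned)
    (sumₚ-cong (suc n) aₜ cₜ λ i i<1+n → ·ₚ-cong (t i) (t i) (a≈coefficient i i<1+n) (≈ₚ-refl (t i)))
    where
    p-spanned = triangular-spans t goncarov.degree (suc n) (p n) (proj₂ (basic.degree n))
    a = proj₁ p-spanned
    aₜ = λ i → a i ·ₚ t i
    cₜ = λ i → coefficient n i ·ₚ t i

    φ-t-offdiag : ∀ {k} i → i ≢ k → φ k (t i) ≈ 0#
    φ-t-offdiag {k} i i≢k = goncarov.offdiag k i (λ k≡i → i≢k (≡.sym k≡i))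

    a≈coefficient : ∀ k → k < suc n → a k ≈ coefficient n k
    a≈coefficient k (s≤s k≤n) = *-cancelʳ-≉0 (a k) (coefficient n k) (ι-!≉0 charZero k) (begin
      a k * ι (k !)                              ≈⟨ *-congˡ (goncarov.diag k) ⟨
      a k * φ k (t k)                            ≈⟨ φ-sum-select (φ-linear k) t a φ-t-offdiag (suc n) (s≤s k≤n) ⟨
      φ k (sumₚ (suc n) aₜ)                      ≈⟨ IsLinearFunctional.cong-≈ (φ-linear k) (p n) (sumₚ (suc n) aₜ)
                                                                                (proj₂ p-spanned) ⟨
      φ k (p n)                                  ≈⟨ φ-p k≤n ⟩
      coefficient n k * ι (k !)                  ∎)

proposition3p7 : {c ℓ : Level} (K : CommutativeRing c ℓ) → IsField K
    → let open Poly K in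
      CharZero
    → (d : Poly → Poly) → IsDeltaOperator d
    → (p : ℕ → Poly) → IsBasicSequence d p
    → (z : ℕ → Carrier) → (t : ℕ → Poly) → IsGoncarovBasis d z t
    → ∀ n →
      (p n ≈ₚ sumₚ (suc n) (λ i → (ι (n C i) * eval (z i) (p (n ∸ i))) ·ₚ t i))
      × (t n ≈ₚ p n +ₚ (- 1#) ·ₚ sumₚ n (λ i → (ι (n C i) * eval (z i) (p (n ∸ i))) ·ₚ t i))
proposition3p7 K isField charZero d delta p basic z t goncarov n =
  expansion n ,
  ≈ₚ-+ₚ-solveʳ (p n) (sumₚ n (λ i → coefficient n i ·ₚ t i)) (t n) (coefficient-diag n) (expansion n)
  where
  open Poly K
  open PolynomialAlgebra K
  open GoncarovExpansion K isField charZero delta basic z goncarov
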